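{- Let $$W_+ = \Big\{(x,y) \in \mathbb{Z}^2 : \tfrac{x+y}{\sqrt 2} > \big(\tfrac{x-y}{\sqrt 2}\big)^2\Big\}, \qquad W_- = \Big\{(x,y) \in \mathbb{Z}^2 : \tfrac{x+y}{\sqrt 2} < \big(\tfrac{x-y}{\sqrt 2}\big)^2\Big\}.$$ Neither $W_+$ nor $W_-$ admits a minimal complement in $\mathbb{Z}^2$.
   Context: For an abelian group $G$ and nonempty subsets $W, W' \subseteq G$, $W'$ is a complement of $W$ in $G$ if $W + W' = G$; it is a minimal complement if moreover $W + (W' \setminus \{w'\}) \neq G$ for every $w' \in W'$. -}

module Defs where

open import Level using (0ℓ)
open import Data.Integer using (ℤ; _+_; _-_; _*_; _<_; 0ℤ; +_)
open import Data.Product using (_×_; _,_; ∃; ∃-syntax; Σ-syntax)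
open import Data.Sum using (_⊎_)
open import Relation.Nullary using (¬_)
open import Relation.Unary using (Pred)
open import Relation.Binary.PropositionalEquality using (_≡_; _≢_)

ℤ² : Set
ℤ² = ℤ × ℤ

_⊕_ : ℤ² → ℤ² → ℤ²
(a , b) ⊕ (c , d) = (a + c , b + d)

Subset : Set₁
Subset = Pred ℤ² 0ℓ

IsComplement : Subset → Subset → Set
IsComplement W W' = ∀ (g : ℤ²) → ∃[ w ] ∃[ w' ] (W w × W' w' × w ⊕ w' ≡ g)

_∖｛_｝ : Subset → ℤ² → Subset
(W' ∖｛ v ｝) u = W' u × u ≢ v

IsMinimalComplement : Subset → Subset → Set
IsMinimalComplement W W' =
  (∃[ w' ] W' w') × IsComplement W W' ×
  (∀ (w' : ℤ²) → W' w' → ¬ IsComplement W (W' ∖｛ w' ｝))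

HasMinimalComplement : Subset → Set₁
HasMinimalComplement W = Σ[ W' ∈ Subset ] IsMinimalComplement W W'

sq : ℤ → ℤ
sq z = z * z

-- With s = x + y and d = x - y, the paper's condition
--   s/√2 > (d/√2)²   ⇔   √2·s > d²
-- is equivalent (over the integers, √2 irrational) to  0 < s ∧ d⁴ < 2s².
W₊ : Subset
W₊ (x , y) = (0ℤ < x + y) × (sq (sq (x - y)) < + 2 * sq (x + y))

-- s/√2 < (d/√2)²   ⇔   √2·s < d²   ⇔   s < 0 ∨ 2s² < d⁴  (over ℤ).
W₋ : Subset
W₋ (x , y) = (x + y < 0ℤ) ⊎ (+ 2 * sq (x + y) < sq (sq (x - y)))

{-# OPTIONS --safe #-}
module Submission where

-- Both sets are regions bounded by a parabola whose axis is the diagonal, so translating along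
-- the diagonal (by (t , t) with t ≥ 0 for W₊, t ≤ 0 for W₋) maps the set into itself, while a
-- large enough translation in the opposite direction moves any given point out of it.  Such a
-- set W has no minimal complement: if W + W' = ℤ² and w₀ ∈ W', then for any g choose a
-- translation v with W + v ⊆ W and g − w₀ − v ∉ W, and write g − v = w + w' with w ∈ W,
-- w' ∈ W'; then g = (w + v) + w' with w + v ∈ W and w' ≠ w₀, so W' ∖ {w₀} is still a complement.

open import Defs
open import Data.Integer hiding (_⊖_)
open import Data.Integer.Properties
open import Data.Integer.Tactic.RingSolver using (solve-∀)
open import Data.Nat.Base using (z≤n; s≤s)
open import Data.Product using (_×_; _,_; ∃-syntax; proj₁; proj₂)
open import Data.Sum using (_⊎_; inj₁; inj₂)
open import Relation.Nullary using (¬_; yes; no)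
open import Relation.Binary.PropositionalEquality

_⊖_ : ℤ² → ℤ² → ℤ²
(a , b) ⊖ (c , d) = (a - c , b - d)

i+j≡k-l⇒i≡k-j-l : ∀ i j k l → i + j ≡ k - l → i ≡ (k - j) - l
i+j≡k-l⇒i≡k-j-l i j k l eq = begin
  i            ≡⟨ cancel i j ⟩
  (i + j) - j  ≡⟨ cong (_- j) eq ⟩
  (k - l) - j  ≡⟨ swap k l j ⟩
  (k - j) - l  ∎
  where
  open ≡-Reasoning
  cancel : ∀ i j → i ≡ (i + j) - j
  cancel = solve-∀
  swap : ∀ k l j → (k - l) - j ≡ (k - j) - l
  swap = solve-∀

i+j≡k-l⇒i+l+j≡k : ∀ i j k l → i + j ≡ k - l → (i + l) + j ≡ k
i+j≡k-l⇒i+l+j≡k i j k l eq = begin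
  (i + l) + j  ≡⟨ swap i l j ⟩
  (i + j) + l  ≡⟨ cong (_+ l) eq ⟩
  (k - l) + l  ≡⟨ cancel k l ⟩
  k            ∎
  where
  open ≡-Reasoning
  swap : ∀ i l j → (i + l) + j ≡ (i + j) + l
  swap = solve-∀
  cancel : ∀ k l → (k - l) + l ≡ k
  cancel = solve-∀

⊕≡⊖⇒≡⊖⊖ : ∀ w w' g v → w ⊕ w' ≡ g ⊖ v → w ≡ (g ⊖ w') ⊖ v
⊕≡⊖⇒≡⊖⊖ (i , i') (j , j') (k , k') (l , l') eq =
  cong₂ _,_ (i+j≡k-l⇒i≡k-j-l i j k l (cong proj₁ eq))
            (i+j≡k-l⇒i≡k-j-l i' j' k' l' (cong proj₂ eq))

⊕≡⊖⇒⊕⊕≡ : ∀ w w' g v → w ⊕ w' ≡ g ⊖ v → (w ⊕ v) ⊕ w' ≡ g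
⊕≡⊖⇒⊕⊕≡ (i , i') (j , j') (k , k') (l , l') eq =
  cong₂ _,_ (i+j≡k-l⇒i+l+j≡k i j k l (cong proj₁ eq))
            (i+j≡k-l⇒i+l+j≡k i' j' k' l' (cong proj₂ eq))

ShiftClosed : Subset → ℤ² → Set
ShiftClosed W v = ∀ w → W w → W (w ⊕ v)

Escapable : Subset → Set
Escapable W = ∀ h → ∃[ v ] ShiftClosed W v × ¬ W (h ⊖ v)

escapable⇒¬HasMinimalComplement : ∀ {W} → Escapable W → ¬ HasMinimalComplement W
escapable⇒¬HasMinimalComplement {W} escape (W' , (w₀ , w₀∈W') , W+W'≡ℤ² , minimal) =
  minimal w₀ w₀∈W' W+[W'∖w₀]≡ℤ²
  where
  W+[W'∖w₀]≡ℤ² : IsComplement W (W' ∖｛ w₀ ｝)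
  W+[W'∖w₀]≡ℤ² g with escape (g ⊖ w₀)
  ... | v , W+v⊆W , g-w₀-v∉W with W+W'≡ℤ² (g ⊖ v)
  ... | w , w' , w∈W , w'∈W' , w+w'≡g-v =
    w ⊕ v , w' , W+v⊆W w w∈W , (w'∈W' , w'≢w₀) , ⊕≡⊖⇒⊕⊕≡ w w' g v w+w'≡g-v
    where
    w'≢w₀ : w' ≢ w₀
    w'≢w₀ refl = g-w₀-v∉W (subst W (⊕≡⊖⇒≡⊖⊖ w w' g v w+w'≡g-v) w∈W)

sq-nonNeg : ∀ i → 0ℤ ≤ sq i
sq-nonNeg +0       = ≤-refl
sq-nonNeg +[1+ _ ] = +≤+ z≤n
sq-nonNeg -[1+ _ ] = +≤+ z≤n

sq-mono-≤ : ∀ {i j} → 0ℤ ≤ i → i ≤ j → sq i ≤ sq j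
sq-mono-≤ {i} {j} 0≤i i≤j = begin
  i * i  ≤⟨ *-monoˡ-≤-nonNeg i {{nonNegative 0≤i}} i≤j ⟩
  i * j  ≤⟨ *-monoʳ-≤-nonNeg j {{nonNegative (≤-trans 0≤i i≤j)}} i≤j ⟩
  j * j  ∎
  where open ≤-Reasoning

i≤2*i : ∀ {i} → 0ℤ ≤ i → i ≤ + 2 * i
i≤2*i {i} 0≤i = begin
  i        ≡⟨ *-identityˡ i ⟨
  + 1 * i  ≤⟨ *-monoʳ-≤-nonNeg i {{nonNegative 0≤i}} (+≤+ (s≤s (z≤n {1}))) ⟩
  + 2 * i  ∎
  where open ≤-Reasoning

i≤+∣i∣ : ∀ i → i ≤ + ∣ i ∣
i≤+∣i∣ (+ _)    = ≤-refl
i≤+∣i∣ -[1+ _ ] = -≤+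

AboveParabola BelowParabola : ℤ → ℤ → Set
AboveParabola s d = (0ℤ < s) × (sq (sq d) < + 2 * sq s)
BelowParabola s d = (s < 0ℤ) ⊎ (+ 2 * sq s < sq (sq d))

aboveParabola-mono : ∀ {s s'} d → s ≤ s' → AboveParabola s d → AboveParabola s' d
aboveParabola-mono _ s≤s' (0<s , d⁴<2s²) =
  <-≤-trans 0<s s≤s' ,
  <-≤-trans d⁴<2s² (*-monoˡ-≤-nonNeg (+ 2) (sq-mono-≤ (<⇒≤ 0<s) s≤s'))

belowParabola-antimono : ∀ {s s'} d → s' ≤ s → BelowParabola s d → BelowParabola s' d
belowParabola-antimono _ s'≤s (inj₁ s<0) = inj₁ (≤-<-trans s'≤s s<0)
belowParabola-antimono {s' = s'} _ s'≤s (inj₂ 2s²<d⁴) with s' <? 0ℤ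
... | yes s'<0 = inj₁ s'<0
... | no  s'≮0 =
  inj₂ (≤-<-trans (*-monoˡ-≤-nonNeg (+ 2) (sq-mono-≤ (≮⇒≥ s'≮0) s'≤s)) 2s²<d⁴)

¬aboveParabola : ∀ {s} d → s ≤ 0ℤ → ¬ AboveParabola s d
¬aboveParabola _ s≤0 (0<s , _) = <-irrefl refl (<-≤-trans 0<s s≤0)

¬belowParabola : ∀ {s} d → sq d ≤ s → ¬ BelowParabola s d
¬belowParabola d d²≤s (inj₁ s<0) =
  <-irrefl refl (≤-<-trans (≤-trans (sq-nonNeg d) d²≤s) s<0)
¬belowParabola {s} d d²≤s (inj₂ 2s²<d⁴) = <-irrefl refl (<-≤-trans 2s²<d⁴ (begin
  sq (sq d)    ≤⟨ sq-mono-≤ (sq-nonNeg d) d²≤s ⟩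
  sq s         ≤⟨ i≤2*i (sq-nonNeg s) ⟩
  + 2 * sq s   ∎))
  where open ≤-Reasoning

diagonal-sum : ∀ x y t → (x + t) + (y + t) ≡ (x + y) + (t + t)
diagonal-sum = solve-∀

diagonal-difference : ∀ x y t → (x + t) - (y + t) ≡ x - y
diagonal-difference = solve-∀

W₊-shiftClosed : ∀ {t} → 0ℤ ≤ t → ShiftClosed W₊ (t , t)
W₊-shiftClosed {t} 0≤t (x , y) above =
  subst₂ AboveParabola (sym (diagonal-sum x y t)) (sym (diagonal-difference x y t))
    (aboveParabola-mono (x - y) s≤s+2t above)
  where
  s≤s+2t : x + y ≤ (x + y) + (t + t)
  s≤s+2t = ≤-trans (≤-reflexive (sym (+-identityʳ (x + y))))
                   (+-monoʳ-≤ (x + y) (+-mono-≤ 0≤t 0≤t))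

W₋-shiftClosed : ∀ {t} → t ≤ 0ℤ → ShiftClosed W₋ (t , t)
W₋-shiftClosed {t} t≤0 (x , y) below =
  subst₂ BelowParabola (sym (diagonal-sum x y t)) (sym (diagonal-difference x y t))
    (belowParabola-antimono (x - y) s+2t≤s below)
  where
  s+2t≤s : (x + y) + (t + t) ≤ x + y
  s+2t≤s = ≤-trans (+-monoʳ-≤ (x + y) (+-mono-≤ t≤0 t≤0))
                   (≤-reflexive (+-identityʳ (x + y)))

-- Below, (a , b) ⊖ (t , t) is definitionally (a , b) ⊕ (- t , - t), whence the shifts by - t.
W₊-escapable : Escapable W₊
W₊-escapable (a , b) = (t , t) , W₊-shiftClosed (+≤+ z≤n) , escaped
  where
  t = + ∣ a + b ∣
  s-2t≤0 : (a + b) + (- t + - t) ≤ 0ℤ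
  s-2t≤0 = begin
    (a + b) + (- t + - t)  ≤⟨ +-monoʳ-≤ (a + b) (i-j≤i (- t) t) ⟩
    (a + b) - t            ≤⟨ i≤j⇒i-j≤0 (i≤+∣i∣ (a + b)) ⟩
    0ℤ                     ∎
    where open ≤-Reasoning
  escaped : ¬ W₊ ((a , b) ⊖ (t , t))
  escaped above = ¬aboveParabola (a - b) s-2t≤0
    (subst₂ AboveParabola (diagonal-sum a b (- t)) (diagonal-difference a b (- t)) above)

W₋-escapable : Escapable W₋
W₋-escapable (a , b) = (- t , - t) , W₋-shiftClosed (neg-mono-≤ (+≤+ z≤n)) , escaped
  where
  t = + ∣ sq (a - b) - (a + b) ∣
  d²≤s+2t : sq (a - b) ≤ (a + b) + (- - t + - - t)
  d²≤s+2t = begin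
    sq (a - b)                        ≡⟨ cancel (a + b) (sq (a - b)) ⟩
    (a + b) + (sq (a - b) - (a + b))  ≤⟨ +-monoʳ-≤ (a + b) (i≤+∣i∣ _) ⟩
    (a + b) + t                       ≤⟨ +-monoʳ-≤ (a + b) (i≤i+j t t) ⟩
    (a + b) + (t + t)                 ≡⟨ cong (λ u → (a + b) + (u + u)) (neg-involutive t) ⟨
    (a + b) + (- - t + - - t)         ∎
    where
    open ≤-Reasoning
    cancel : ∀ s e → e ≡ s + (e - s)
    cancel = solve-∀
  escaped : ¬ W₋ ((a , b) ⊖ (- t , - t))
  escaped below = ¬belowParabola (a - b) d²≤s+2t
    (subst₂ BelowParabola (diagonal-sum a b (- - t)) (diagonal-difference a b (- - t)) below)

corollary3p6 : ¬ HasMinimalComplement W₊ × ¬ HasMinimalComplement W₋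
corollary3p6 =
  escapable⇒¬HasMinimalComplement W₊-escapable ,
  escapable⇒¬HasMinimalComplement W₋-escapable
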